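{- Let $m\ge 0$ be an integer and $g=30m+12$. There exists an almost $5$-star factor $F$ on $\{0,1,\dots,30m+11\}$ with $t=0$ isolated vertices (i.e., a spanning subgraph all of whose components are copies of $K_{1,5}$) such that: (i) every $d\in\{1,2,\dots,15m+5\}$ is the forward difference of at least one edge of $F$; (ii) every $d\in\{1,2,\dots,15m+5\}$ is the forward difference of at most two edges of $F$; (iii) $F$ has no wrap-around edges; (iv) there is a pure/prime labelling of $F$ with respect to which none of the $5$-star components of $F$ is mixed.
   Context: Let $g\ge 1$ and $t\in\{0,\dots,5\}$ with $g\equiv t\pmod 6$. An almost $5$-star factor on $\{0,1,\dots,g-1\}$ with $t$ isolated vertices is a graph $F$ on this vertex set such that the vertex set is partitioned into $(g-t)/6$ six-element sets, each spanning a connected component of $F$ isomorphic to $K_{1,5}$ (a $5$-star), and one $t$-element set $X$ (the isolated vertices) on which $F$ induces a star $K_{1,t-1}$ (the little star; empty when $t=0$), and $F$ has no other edges. For an edge $\{u,w\}$ with $u<w$, its difference is $\min\{w-u,\,g-(w-u)\}$; the edge is a forward edge if its difference equals $w-u$ (and then $w-u$ is its forward difference), and a wrap-around edge otherwise. A pure/prime labelling of $F$ assigns to each edge of $F$ one of the labels "pure" or "prime" so that no two pure edges have the same difference and no two prime edges have the same difference. With respect to such a labelling, a star is pure (resp. prime) if all its edges are pure (resp. prime), and mixed if it contains both a pure and a prime edge. -}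

module Defs where

open import Data.Nat using (ℕ; zero; suc; _+_; _*_; _∸_; _≤_; _⊔_; _⊓_; _≟_)
open import Data.Bool using (Bool)
open import Data.Product using (Σ; _×_; _,_; proj₁; proj₂; ∃)
open import Data.Fin using (Fin)
open import Data.Vec using (Vec)
import Data.Vec as Vec
open import Data.List using (List; length; concatMap; map; filter; upTo; concat; tabulate; lookup)
open import Data.List.Membership.Propositional using (_∈_)
open import Data.List.Relation.Unary.All using (All)
open import Data.List.Relation.Unary.Unique.Propositional using (Unique)
open import Data.List.Relation.Binary.Permutation.Propositional using (_↭_)
open import Relation.Binary.PropositionalEquality using (_≡_)
open import Relation.Nullary using (¬_; Dec; yes; no)
open import Relation.Nullary.Decidable using (_×-dec_)

record Star : Set where
  constructor star
  field
    centre : ℕ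
    leaves : Vec ℕ 5
open Star public

verts : Star → List ℕ
verts s = centre s Data.List.∷ Vec.toList (leaves s)

-- F is an almost 5-star factor on {0,…,g-1} with t = 0 isolated vertices
-- iff the vertex sets of the stars partition {0,…,g-1}, i.e. the concatenation
-- of their vertex lists is a permutation of [0, …, g-1].
FiveStarFactor : ℕ → List Star → Set
FiveStarFactor g F = concatMap verts F ↭ upTo g

-- An edge is an (unordered) pair of vertices, stored as (centre , leaf).
Edge : Set
Edge = ℕ × ℕ

starEdges : Star → List Edge
starEdges s = Vec.toList (Vec.map (λ l → centre s , l) (leaves s))

edges : List Star → List Edge
edges F = concatMap starEdges F

len : Edge → ℕ
len (a , b) = (a ⊔ b) ∸ (a ⊓ b)

diff : ℕ → Edge → ℕ
diff g e = len e ⊓ (g ∸ len e)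

IsForward : ℕ → Edge → Set
IsForward g e = diff g e ≡ len e

IsWrapAround : ℕ → Edge → Set
IsWrapAround g e = ¬ IsForward g e

HasForwardDiff : ℕ → ℕ → Edge → Set
HasForwardDiff g d e = IsForward g e × len e ≡ d

hasForwardDiff? : ∀ g d (e : Edge) → Dec (HasForwardDiff g d e)
hasForwardDiff? g d e = (diff g e ≟ len e) ×-dec (len e ≟ d)

countForward : ℕ → ℕ → List Star → ℕ
countForward g d F = length (filter (hasForwardDiff? g d) (edges F))

data Label : Set where
  pure prime : Label

_≟L_ : (a b : Label) → Dec (a ≡ b)
pure  ≟L pure  = yes Relation.Binary.PropositionalEquality.refl
pure  ≟L prime = no (λ ())
prime ≟L pure  = no (λ ())
prime ≟L prime = yes Relation.Binary.PropositionalEquality.refl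

-- A labelling of F: a label for the j-th edge (centre, j-th leaf) of the i-th star.
Labelling : List Star → Set
Labelling F = Fin (length F) → Fin 5 → Label

labelledEdges : (F : List Star) → Labelling F → List (Label × Edge)
labelledEdges F λl = concat (tabulate {n = length F} (λ i →
  Vec.toList (Vec.tabulate (λ j → λl i j , (centre (lookup F i) , Vec.lookup (leaves (lookup F i)) j)))))

diffsWithLabel : ℕ → Label → (F : List Star) → Labelling F → List ℕ
diffsWithLabel g L F λl =
  map (λ p → diff g (proj₂ p)) (filter (λ p → proj₁ p ≟L L) (labelledEdges F λl))

IsPurePrimeLabelling : ℕ → (F : List Star) → Labelling F → Set
IsPurePrimeLabelling g F λl =
  Unique (diffsWithLabel g pure F λl) × Unique (diffsWithLabel g prime F λl)

Mixed : (F : List Star) → Labelling F → Fin (length F) → Set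
Mixed F λl i = (∃ λ j → λl i j ≡ pure) × (∃ λ k → λl i k ≡ prime)

{-# OPTIONS --safe #-}
module Submission where

-- A block on the 6M + 1 vertices s, …, s + 6M (M = c + f, c ∈ {f, f + 1}) consists of c centres,
-- then 5M leaves forming a 5 × M grid whose columns x, x + M, …, x + 4M are the leaf sets of the
-- stars, then one unused vertex (the hole), then f centres.  The c "up" stars lie below their
-- columns at odd distances δ and the f "down" stars above theirs at even distances, so the
-- lengths δ + jM (0 ≤ j ≤ 4) of all edges run exactly once through 1, …, 5M.
-- For g = 30m + 12, block A with M = 3m + 1 realises every difference 1, …, 15m + 5 and is
-- labelled pure.  Block B with M = 2m realises 1, …, 10m; the last star, centred in the hole of A
-- with leaves at the hole of B and the last four vertices, has lengths in (10m, 15m + 6]; these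
-- are labelled prime.  No length exceeds g/2, so every edge is forward and lengths are differences.

open import Defs
open import Data.Nat using (ℕ; _+_; _*_; _≤_)
open import Data.Product using (Σ; _×_; ∃)
open import Data.Fin using (Fin)
open import Data.List using (List; length)
open import Data.List.Membership.Propositional using (_∈_)
open import Data.List.Relation.Unary.All using (All)
open import Relation.Nullary using (¬_)

open import Data.Nat
open import Data.Nat.Properties
open import Data.Nat.Tactic.RingSolver using (solve; solve-∀)
open import Data.Product using (_,_; proj₁; proj₂)
open import Data.Sum using (_⊎_; inj₁; inj₂)
open import Data.Fin using (toℕ)
open import Data.List using ([]; _∷_; _++_; map; concatMap; filter; reverse; applyUpTo; applyDownFrom; upTo)
open import Data.List.Properties
  using (concatMap-++; concatMap-map; map-concatMap; map-id; map-++; map-cong-local; ++-assoc; ++-identityʳ;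
         filter-++; filter-none; filter-accept; filter-reject; length-++)
open import Data.List.Membership.Propositional.Properties using (∈-map⁻; ∈-++⁺ˡ)
open import Data.List.Relation.Unary.Any using (here; there)
import Data.List.Relation.Unary.All as All
import Data.List.Relation.Unary.All.Properties as All
import Data.List.Relation.Unary.AllPairs as AllPairs
open import Data.List.Relation.Unary.Unique.Propositional using (Unique)
import Data.List.Relation.Unary.Unique.Propositional.Properties as Unique
open import Data.List.Relation.Binary.Permutation.Propositional
  using (_↭_; ↭-refl; ↭-prep; ↭-trans; ↭-sym; ↭-reflexive; ↭⇒↭ₛ; module PermutationReasoning)
open import Data.List.Relation.Binary.Permutation.Propositional.Properties
  using (++⁺; ++⁺ˡ; ++-comm; shifts; ↭-reverse; ∈-resp-↭; All-resp-↭; ++-commutativeMonoid)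
import Data.List.Relation.Binary.Permutation.Setoid.Properties as Setoidₚ
open import Algebra.Solver.CommutativeMonoid (++-commutativeMonoid {A = ℕ})
  using (_⊜_; _⊕_) renaming (solve to ↭-solve)
open import Data.Vec as Vec using (Vec)
open import Relation.Nullary using (Dec; yes; no; contradiction)
open import Relation.Binary.PropositionalEquality
open import Function using (_∘_)

interval : ℕ → ℕ → List ℕ
interval a zero    = []
interval a (suc n) = a ∷ interval (suc a) n

interval-++ : ∀ {a b} n k → a + n ≡ b → interval a n ++ interval b k ≡ interval a (n + k)
interval-++ {a} zero    k refl = cong (λ x → interval x k) (+-identityʳ a)
interval-++ {a} (suc n) k refl = cong (a ∷_) (interval-++ n k (sym (+-suc a n)))

applyUpTo≡interval : ∀ (f : ℕ → ℕ) a n → (∀ i → f i ≡ a + i) → applyUpTo f n ≡ interval a n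
applyUpTo≡interval f a zero    f≗a+ = refl
applyUpTo≡interval f a (suc n) f≗a+ = cong₂ _∷_ (trans (f≗a+ 0) (+-identityʳ a))
  (applyUpTo≡interval (f ∘ suc) (suc a) n (λ i → trans (f≗a+ (suc i)) (+-suc a i)))

upTo≡interval : ∀ n → upTo n ≡ interval 0 n
upTo≡interval n = applyUpTo≡interval (λ i → i) 0 n (λ _ → refl)

applyDownFrom-+↭interval : ∀ a n → applyDownFrom (a +_) n ↭ interval a n
applyDownFrom-+↭interval a zero    = ↭-refl
applyDownFrom-+↭interval a (suc n) = begin
  a + n ∷ applyDownFrom (a +_) n  ↭⟨ ↭-prep (a + n) (applyDownFrom-+↭interval a n) ⟩
  a + n ∷ interval a n            ↭⟨ ++-comm (a + n ∷ []) (interval a n) ⟩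
  interval a n ++ a + n ∷ []      ≡⟨ interval-++ n 1 refl ⟩
  interval a (n + 1)              ≡⟨ cong (interval a) (+-comm n 1) ⟩
  interval a (suc n)              ∎
  where open PermutationReasoning

∈-interval⁻ : ∀ {a x} n → x ∈ interval a n → a ≤ x × x < a + n
∈-interval⁻ {a} (suc n) (here refl) = ≤-refl , m<m+n a z<s
∈-interval⁻ {a} {x} (suc n) (there x∈) with a<x , x<a+n ← ∈-interval⁻ n x∈ =
  <⇒≤ a<x , subst (x <_) (sym (+-suc a n)) x<a+n

∈-interval⁺ : ∀ {a x} n → a ≤ x → x < a + n → x ∈ interval a n
∈-interval⁺ {a} zero    a≤x x<a+0 = contradiction (subst (_ <_) (+-identityʳ a) x<a+0) (≤⇒≯ a≤x)
∈-interval⁺ {a} {x} (suc n) a≤x x<a+n with a ≟ x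
... | yes refl = here refl
... | no  a≢x  = there (∈-interval⁺ n (≤∧≢⇒< a≤x a≢x) (subst (x <_) (+-suc a n) x<a+n))

All-interval : ∀ {P : ℕ → Set} a n → (∀ {x} → a ≤ x → x < a + n → P x) → All P (interval a n)
All-interval a n p = All.tabulate λ x∈ → let a≤x , x<a+n = ∈-interval⁻ n x∈ in p a≤x x<a+n

interval-unique : ∀ a n → Unique (interval a n)
interval-unique a zero    = AllPairs.[]
interval-unique a (suc n) =
  All.tabulate (λ x∈ a≡x → <-irrefl a≡x (proj₁ (∈-interval⁻ n x∈))) AllPairs.∷ interval-unique (suc a) n

Unique-++-separated : ∀ k {xs ys : List ℕ} → All (_< k) xs → All (k ≤_) ys →
                      Unique xs → Unique ys → Unique (xs ++ ys)
Unique-++-separated k xs<k k≤ys uxs uys = Unique.++⁺ uxs uys λ (v∈xs , v∈ys) →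
  <⇒≱ (All.lookup xs<k v∈xs) (All.lookup k≤ys v∈ys)

Unique-resp-↭ : ∀ {xs ys : List ℕ} → xs ↭ ys → Unique xs → Unique ys
Unique-resp-↭ xs↭ys = Setoidₚ.Unique-resp-↭ (setoid ℕ) (↭⇒↭ₛ xs↭ys)

module _ {A B : Set} where

  concatMap⁺ : (f : A → List B) {xs ys : List A} → xs ↭ ys → concatMap f xs ↭ concatMap f ys
  concatMap⁺ f (_↭_.refl)       = ↭-refl
  concatMap⁺ f (_↭_.prep x p)   = ++⁺ˡ (f x) (concatMap⁺ f p)
  concatMap⁺ f (_↭_.swap x y p) = ↭-trans (shifts (f x) (f y)) (++⁺ˡ (f y) (++⁺ˡ (f x) (concatMap⁺ f p)))
  concatMap⁺ f (_↭_.trans p q)  = ↭-trans (concatMap⁺ f p) (concatMap⁺ f q)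

  concatMap-∷↭ : (h : A → B) (t : A → List B) (xs : List A) →
                 concatMap (λ x → h x ∷ t x) xs ↭ map h xs ++ concatMap t xs
  concatMap-∷↭ h t []       = ↭-refl
  concatMap-∷↭ h t (x ∷ xs) = ↭-prep (h x) (↭-trans (++⁺ˡ (t x) (concatMap-∷↭ h t xs)) (shifts (t x) (map h xs)))

map-+-interval : ∀ k a n → map (_+ k) (interval a n) ≡ interval (a + k) n
map-+-interval k a zero    = refl
map-+-interval k a (suc n) = cong (a + k ∷_) (map-+-interval k (suc a) n)

progression : ℕ → ℕ → (r : ℕ) → Vec ℕ r
progression x M zero    = Vec.[]
progression x M (suc r) = x Vec.∷ progression (x + M) M r

column : ℕ → ℕ → ℕ → List ℕ
column r M x = Vec.toList (progression x M r)

columns↭interval : ∀ r M a → concatMap (column r M) (interval a M) ↭ interval a (r * M)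
columns↭interval zero    M a = ↭-reflexive (concatMap-[] (interval a M))
  where
  concatMap-[] : ∀ xs → concatMap (column 0 M) xs ≡ []
  concatMap-[] []       = refl
  concatMap-[] (x ∷ xs) = concatMap-[] xs
columns↭interval (suc r) M a = begin
  concatMap (λ x → x ∷ column r M (x + M)) (interval a M)
    ↭⟨ concatMap-∷↭ (λ x → x) (column r M ∘ (_+ M)) (interval a M) ⟩
  map (λ x → x) (interval a M) ++ concatMap (column r M ∘ (_+ M)) (interval a M)
    ≡⟨ cong₂ _++_ (map-id (interval a M)) (sym (concatMap-map (column r M) (_+ M) (interval a M))) ⟩
  interval a M ++ concatMap (column r M) (map (_+ M) (interval a M))
    ≡⟨ cong (λ xs → interval a M ++ concatMap (column r M) xs) (map-+-interval M a M) ⟩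
  interval a M ++ concatMap (column r M) (interval (a + M) M)
    ↭⟨ ++⁺ˡ (interval a M) (columns↭interval r M (a + M)) ⟩
  interval a M ++ interval (a + M) (r * M)
    ≡⟨ interval-++ M (r * M) refl ⟩
  interval a (M + r * M) ∎
  where open PermutationReasoning

everyOther : ℕ → ℕ → List ℕ
everyOther d zero    = []
everyOther d (suc n) = d ∷ everyOther (2 + d) n

Balanced : ℕ → ℕ → Set
Balanced c f = c ≡ f ⊎ c ≡ suc f

⌈n/2⌉-⌊n/2⌋-balanced : ∀ n → Balanced ⌈ n /2⌉ ⌊ n /2⌋
⌈n/2⌉-⌊n/2⌋-balanced zero          = inj₁ refl
⌈n/2⌉-⌊n/2⌋-balanced (suc zero)    = inj₂ refl
⌈n/2⌉-⌊n/2⌋-balanced (suc (suc n)) with ⌈n/2⌉-⌊n/2⌋-balanced n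
... | inj₁ eq = inj₁ (cong suc eq)
... | inj₂ eq = inj₂ (cong suc eq)

everyOther-interleave : ∀ d c f → Balanced c f →
                        everyOther d c ++ everyOther (suc d) f ↭ interval d (c + f)
everyOther-interleave d zero    .zero (inj₁ refl) = ↭-refl
everyOther-interleave d (suc c) f     balanced    = ↭-prep d (begin
  everyOther (2 + d) c ++ everyOther (suc d) f  ↭⟨ ++-comm (everyOther (2 + d) c) (everyOther (suc d) f) ⟩
  everyOther (suc d) f ++ everyOther (2 + d) c  ↭⟨ everyOther-interleave (suc d) f c (swapped balanced) ⟩
  interval (suc d) (f + c)                      ≡⟨ cong (interval (suc d)) (+-comm f c) ⟩
  interval (suc d) (c + f)                      ∎)
  where
  open PermutationReasoning
  swapped : Balanced (suc c) f → Balanced f c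
  swapped (inj₁ eq) = inj₂ (sym eq)
  swapped (inj₂ eq) = inj₁ (sym (suc-injective eq))

len-comm : ∀ a b → len (a , b) ≡ len (b , a)
len-comm a b = cong₂ _∸_ (⊔-comm a b) (⊓-comm a b)

len-above : ∀ {C l} t → l ≡ C + t → len (C , l) ≡ t
len-above {C} t refl = trans (cong₂ _∸_ (m≤n⇒m⊔n≡n (m≤m+n C t)) (m≤n⇒m⊓n≡m (m≤m+n C t))) (m+n∸m≡n C t)

len-below : ∀ {z l} t → z ≡ l + t → len (z , l) ≡ t
len-below {z} {l} t eq = trans (len-comm z l) (len-above t eq)

lengths-to-interval : ∀ C t k → map (λ l → len (C , l)) (interval (C + t) k) ≡ interval t k
lengths-to-interval C t zero    = refl
lengths-to-interval C t (suc k) = cong₂ _∷_ (len-above {C} t refl)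
  (trans (cong (λ x → map (λ l → len (C , l)) (interval x k)) (sym (+-suc C t))) (lengths-to-interval C (suc t) k))

starLengths : Star → List ℕ
starLengths s = map len (starEdges s)

leafList : Star → List ℕ
leafList s = Vec.toList (leaves s)

upStar : ℕ → ℕ → ℕ → Star
upStar M C d = star C (progression (C + d) M 5)

downStar : ℕ → ℕ → ℕ → Star
downStar M b e = star (b + 4 * M + e) (progression b M 5)

upStar-lengths : ∀ M C d → starLengths (upStar M C d) ≡ column 5 M d
upStar-lengths M C d = lengths 5 d
  where
  lengths : ∀ r t → map (λ l → len (C , l)) (column r M (C + t)) ≡ column r M t
  lengths zero    t = refl
  lengths (suc r) t = cong₂ _∷_ (len-above {C} t refl)
    (trans (cong (λ x → map (λ l → len (C , l)) (column r M x)) (+-assoc C t M)) (lengths r (t + M)))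

downStar-lengths : ∀ M b e → starLengths (downStar M b e) ↭ column 5 M e
downStar-lengths M b e = ↭-trans (↭-reflexive reversed) (↭-reverse (column 5 M e))
  where
  reversed : starLengths (downStar M b e) ≡ reverse (column 5 M e)
  reversed =
    cong₂ _∷_ (at b (e + M + M + M + M) (solve (b ∷ M ∷ e ∷ [])))
    (cong₂ _∷_ (at (b + M) (e + M + M + M) (solve (b ∷ M ∷ e ∷ [])))
    (cong₂ _∷_ (at (b + M + M) (e + M + M) (solve (b ∷ M ∷ e ∷ [])))
    (cong₂ _∷_ (at (b + M + M + M) (e + M) (solve (b ∷ M ∷ e ∷ [])))
    (cong₂ _∷_ (at (b + M + M + M + M) e (solve (b ∷ M ∷ e ∷ []))) refl))))
    where
    at : ∀ l t → b + 4 * M + e ≡ l + t → len (b + 4 * M + e , l) ≡ t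
    at l t = len-below t

-- upStars M s d n has centres s + n − 1, …, s at distances d, d + 2, …, d + 2n − 2 below their
-- columns, which are therefore consecutive; dually for downStars.
upStars : ℕ → ℕ → ℕ → ℕ → List Star
upStars M s d zero    = []
upStars M s d (suc n) = upStar M (s + n) d ∷ upStars M s (2 + d) n

downStars : ℕ → ℕ → ℕ → ℕ → List Star
downStars M q e zero    = []
downStars M q e (suc n) = downStar M (q + n) e ∷ downStars M q (2 + e) n

upStars-lengths : ∀ M s d n → concatMap starLengths (upStars M s d n) ≡ concatMap (column 5 M) (everyOther d n)
upStars-lengths M s d zero    = refl
upStars-lengths M s d (suc n) = cong₂ _++_ (upStar-lengths M (s + n) d) (upStars-lengths M s (2 + d) n)

downStars-lengths : ∀ M q e n → concatMap starLengths (downStars M q e n) ↭ concatMap (column 5 M) (everyOther e n)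
downStars-lengths M q e zero    = ↭-refl
downStars-lengths M q e (suc n) = ++⁺ (downStar-lengths M (q + n) e) (downStars-lengths M q (2 + e) n)

upStars-centres : ∀ M s d n → map centre (upStars M s d n) ≡ applyDownFrom (s +_) n
upStars-centres M s d zero    = refl
upStars-centres M s d (suc n) = cong (s + n ∷_) (upStars-centres M s (2 + d) n)

upStars-leaves : ∀ M s d n → concatMap leafList (upStars M s (suc d) n) ≡ concatMap (column 5 M) (interval (s + n + d) n)
upStars-leaves M s d zero    = refl
upStars-leaves M s d (suc n) = trans
  (cong (column 5 M (s + n + suc d) ++_) (upStars-leaves M s (2 + d) n))
  (cong₂ (λ x y → column 5 M x ++ concatMap (column 5 M) (interval y n))
    (solve (s ∷ n ∷ d ∷ [])) (solve (s ∷ n ∷ d ∷ [])))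

downStars-centres : ∀ M q e n → map centre (downStars M q (suc e) n) ≡ interval (q + n + 4 * M + e) n
downStars-centres M q e zero    = refl
downStars-centres M q e (suc n) = cong₂ _∷_ head (trans (downStars-centres M q (2 + e) n) (cong (λ x → interval x n) next))
  where
  head : q + n + 4 * M + suc e ≡ q + suc n + 4 * M + e
  head = solve (q ∷ n ∷ M ∷ e ∷ [])
  next : q + n + 4 * M + suc (suc e) ≡ suc (q + suc n + 4 * M + e)
  next = solve (q ∷ n ∷ M ∷ e ∷ [])

downStars-leaves : ∀ M q e n → concatMap leafList (downStars M q e n) ≡ concatMap (column 5 M) (applyDownFrom (q +_) n)
downStars-leaves M q e zero    = refl
downStars-leaves M q e (suc n) = cong (column 5 M (q + n) ++_) (downStars-leaves M q (2 + e) n)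

concatMap-verts↭ : ∀ F → concatMap verts F ↭ map centre F ++ concatMap leafList F
concatMap-verts↭ = concatMap-∷↭ centre leafList

upStars-verts : ∀ M s d n →
  concatMap verts (upStars M s (suc d) n) ↭ interval s n ++ concatMap (column 5 M) (interval (s + n + d) n)
upStars-verts M s d n = begin
  concatMap verts U
    ↭⟨ concatMap-verts↭ U ⟩
  map centre U ++ concatMap leafList U
    ≡⟨ cong₂ _++_ (upStars-centres M s (suc d) n) (upStars-leaves M s d n) ⟩
  applyDownFrom (s +_) n ++ concatMap (column 5 M) (interval (s + n + d) n)
    ↭⟨ ++⁺ (applyDownFrom-+↭interval s n) ↭-refl ⟩
  interval s n ++ concatMap (column 5 M) (interval (s + n + d) n) ∎
  where
  open PermutationReasoning
  U : List Star
  U = upStars M s (suc d) n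

downStars-verts : ∀ M q e n →
  concatMap verts (downStars M q (suc e) n) ↭ interval (q + n + 4 * M + e) n ++ concatMap (column 5 M) (interval q n)
downStars-verts M q e n = begin
  concatMap verts D
    ↭⟨ concatMap-verts↭ D ⟩
  map centre D ++ concatMap leafList D
    ≡⟨ cong₂ _++_ (downStars-centres M q e n) (downStars-leaves M q (suc e) n) ⟩
  interval (q + n + 4 * M + e) n ++ concatMap (column 5 M) (applyDownFrom (q +_) n)
    ↭⟨ ++⁺ˡ _ (concatMap⁺ (column 5 M) (applyDownFrom-+↭interval q n)) ⟩
  interval (q + n + 4 * M + e) n ++ concatMap (column 5 M) (interval q n) ∎
  where
  open PermutationReasoning
  D : List Star
  D = downStars M q (suc e) n

block : ℕ → ℕ → ℕ → List Star
block s c f = upStars (c + f) s 1 c ++ downStars (c + f) (s + c + c) 2 f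

hole : ℕ → ℕ → ℕ → ℕ
hole s c f = s + c + 5 * (c + f)

block-lengths : ∀ s c f → Balanced c f → map len (edges (block s c f)) ↭ interval 1 (5 * (c + f))
block-lengths s c f balanced = begin
  map len (edges (U ++ D))
    ≡⟨ map-concatMap len starEdges (U ++ D) ⟩
  concatMap starLengths (U ++ D)
    ≡⟨ concatMap-++ starLengths U D ⟩
  concatMap starLengths U ++ concatMap starLengths D
    ↭⟨ ++⁺ (↭-reflexive (upStars-lengths M s 1 c)) (downStars-lengths M (s + c + c) 2 f) ⟩
  concatMap (column 5 M) (everyOther 1 c) ++ concatMap (column 5 M) (everyOther 2 f)
    ≡⟨ concatMap-++ (column 5 M) (everyOther 1 c) (everyOther 2 f) ⟨
  concatMap (column 5 M) (everyOther 1 c ++ everyOther 2 f)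
    ↭⟨ concatMap⁺ (column 5 M) (everyOther-interleave 1 c f balanced) ⟩
  concatMap (column 5 M) (interval 1 M)
    ↭⟨ columns↭interval 5 M 1 ⟩
  interval 1 (5 * M) ∎
  where
  open PermutationReasoning
  M : ℕ
  M = c + f
  U D : List Star
  U = upStars M s 1 c
  D = downStars M (s + c + c) 2 f

block-verts-intervals : ∀ s c f →
  concatMap verts (block s c f) ↭ interval s c ++ (interval (s + c) (5 * (c + f)) ++ interval (suc (hole s c f)) f)
block-verts-intervals s c f = begin
  concatMap verts (U ++ D)
    ≡⟨ concatMap-++ verts U D ⟩
  concatMap verts U ++ concatMap verts D
    ↭⟨ ++⁺ (upStars-verts M s 0 c) (downStars-verts M q 1 f) ⟩
  (interval s c ++ colsU) ++ (interval (q + f + 4 * M + 1) f ++ colsD)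
    ≡⟨ cong (λ x → (interval s c ++ colsU) ++ (interval x f ++ colsD)) after-hole ⟩
  (interval s c ++ colsU) ++ (interval (suc (hole s c f)) f ++ colsD)
    ↭⟨ ↭-solve 4 (λ is cu cd iD → (is ⊕ cu) ⊕ (iD ⊕ cd) ⊜ is ⊕ ((cu ⊕ cd) ⊕ iD))
                 ↭-refl (interval s c) colsU colsD (interval (suc (hole s c f)) f) ⟩
  interval s c ++ ((colsU ++ colsD) ++ interval (suc (hole s c f)) f)
    ≡⟨ cong (λ x → interval s c ++ (x ++ interval (suc (hole s c f)) f)) leaf-columns ⟩
  interval s c ++ (concatMap (column 5 M) (interval (s + c) M) ++ interval (suc (hole s c f)) f)
    ↭⟨ ++⁺ˡ (interval s c) (++⁺ (columns↭interval 5 M (s + c)) ↭-refl) ⟩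
  interval s c ++ (interval (s + c) (5 * M) ++ interval (suc (hole s c f)) f) ∎
  where
  open PermutationReasoning
  M q : ℕ
  M = c + f
  q = s + c + c
  U D : List Star
  U = upStars M s 1 c
  D = downStars M q 2 f
  colsU colsD : List ℕ
  colsU = concatMap (column 5 M) (interval (s + c + 0) c)
  colsD = concatMap (column 5 M) (interval q f)
  after-hole : s + c + c + f + 4 * (c + f) + 1 ≡ suc (s + c + 5 * (c + f))
  after-hole = solve (s ∷ c ∷ f ∷ [])
  s+c+0≡s+c : s + c + 0 ≡ s + c
  s+c+0≡s+c = +-identityʳ (s + c)
  leaf-columns : colsU ++ colsD ≡ concatMap (column 5 M) (interval (s + c) M)
  leaf-columns = trans (sym (concatMap-++ (column 5 M) (interval (s + c + 0) c) (interval q f)))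
    (cong (concatMap (column 5 M)) (trans (interval-++ c f (cong (_+ c) s+c+0≡s+c)) (cong (λ x → interval x M) s+c+0≡s+c)))

block-verts : ∀ s c f → hole s c f ∷ concatMap verts (block s c f) ↭ interval s (suc (6 * (c + f)))
block-verts s c f = begin
  h ∷ concatMap verts (block s c f)
    ↭⟨ ↭-prep h (block-verts-intervals s c f) ⟩
  h ∷ (interval s c ++ (interval (s + c) (5 * M) ++ interval (suc h) f))
    ↭⟨ ↭-solve 4 (λ x is il iD → x ⊕ (is ⊕ (il ⊕ iD)) ⊜ is ⊕ (il ⊕ (x ⊕ iD)))
                 ↭-refl (h ∷ []) (interval s c) (interval (s + c) (5 * M)) (interval (suc h) f) ⟩
  interval s c ++ (interval (s + c) (5 * M) ++ interval h (suc f))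
    ≡⟨ cong (interval s c ++_) (interval-++ (5 * M) (suc f) refl) ⟩
  interval s c ++ interval (s + c) (5 * M + suc f)
    ≡⟨ interval-++ c (5 * M + suc f) refl ⟩
  interval s (c + (5 * M + suc f))
    ≡⟨ cong (interval s) size ⟩
  interval s (suc (6 * M)) ∎
  where
  open PermutationReasoning
  M h : ℕ
  M = c + f
  h = hole s c f
  size : c + (5 * (c + f) + suc f) ≡ suc (6 * (c + f))
  size = solve (c ∷ f ∷ [])

edges-++ : ∀ A R → edges (A ++ R) ≡ edges A ++ edges R
edges-++ = concatMap-++ starEdges

lengths-++ : ∀ A R → map len (edges (A ++ R)) ≡ map len (edges A) ++ map len (edges R)
lengths-++ A R = trans (cong (map len) (edges-++ A R)) (map-++ len (edges A) (edges R))

module _ {g : ℕ} where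

  short⇒forward : ∀ {h} e → g ≡ h + h → len e ≤ h → IsForward g e
  short⇒forward {h} e refl len≤h = m≤n⇒m⊓n≡m (begin
    len e          ≤⟨ len≤h ⟩
    h              ≡⟨ m+n∸m≡n h h ⟨
    h + h ∸ h      ≤⟨ ∸-monoʳ-≤ (h + h) len≤h ⟩
    h + h ∸ len e  ∎)
    where open ≤-Reasoning

  forward-edges : ∀ {h es} → g ≡ h + h → All (_≤ h) (map len es) → All (IsForward g) es
  forward-edges g≡h+h short = All.map (λ {e} → short⇒forward e g≡h+h) (All.map⁻ short)

  unique-diffs : ∀ {es} → All (IsForward g) es → Unique (map len es) → Unique (map (diff g) es)
  unique-diffs forward = subst Unique (sym (map-cong-local forward))

  forwardDiff-cover : ∀ {d es} → All (IsForward g) es → d ∈ map len es → ∃ λ e → e ∈ es × HasForwardDiff g d e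
  forwardDiff-cover forward d∈ with e , e∈ , refl ← ∈-map⁻ len d∈ = e , e∈ , All.lookup forward e∈ , refl

  module _ (d : ℕ) where

    private
      P? : ∀ e → Dec (HasForwardDiff g d e)
      P? = hasForwardDiff? g d

    forwardDiff-count≤1 : ∀ es → Unique (map (diff g) es) → length (filter P? es) ≤ 1
    forwardDiff-count≤1 []       _ = z≤n
    forwardDiff-count≤1 (e ∷ es) (e∉ AllPairs.∷ unique) with P? e
    ... | yes e✓@(fwd , len≡d) = ≤-reflexive (cong length (begin
      filter P? (e ∷ es)   ≡⟨ filter-accept P? e✓ ⟩
      e ∷ filter P? es     ≡⟨ cong (e ∷_) (filter-none P? others) ⟩
      e ∷ []               ∎))
      where
      open ≡-Reasoning
      others : All (λ e′ → ¬ HasForwardDiff g d e′) es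
      others = All.map (λ diff≢ (fwd′ , len≡) → diff≢ (trans (trans fwd len≡d) (sym (trans fwd′ len≡))))
                       (All.map⁻ e∉)
    ... | no e✗ = ≤-trans (≤-reflexive (cong length (filter-reject P? {e} {es} e✗))) (forwardDiff-count≤1 es unique)

    countForward-++ : ∀ A R → Unique (map (diff g) (edges A)) → Unique (map (diff g) (edges R)) →
                      countForward g d (A ++ R) ≤ 2
    countForward-++ A R uniqueA uniqueR = begin
      length (filter P? (edges (A ++ R)))
        ≡⟨ cong (length ∘ filter P?) (edges-++ A R) ⟩
      length (filter P? (edges A ++ edges R))
        ≡⟨ cong length (filter-++ P? (edges A) (edges R)) ⟩
      length (filter P? (edges A) ++ filter P? (edges R))
        ≡⟨ length-++ (filter P? (edges A)) ⟩
      length (filter P? (edges A)) + length (filter P? (edges R))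
        ≤⟨ +-mono-≤ (forwardDiff-count≤1 (edges A) uniqueA) (forwardDiff-count≤1 (edges R) uniqueR) ⟩
      2 ∎
      where open ≤-Reasoning

firstPure : ℕ → ℕ → Label
firstPure zero    _       = prime
firstPure (suc k) zero    = pure
firstPure (suc k) (suc i) = firstPure k i

splitLabelling : (A R : List Star) → Labelling (A ++ R)
splitLabelling A R i _ = firstPure (length A) (toℕ i)

starwise-unmixed : ∀ F (h : Fin (length F) → Label) i → ¬ Mixed F (λ i _ → h i) i
starwise-unmixed F h i ((_ , pure≡) , (_ , prime≡)) with () ← trans (sym pure≡) prime≡

labelledStar-const : ∀ (L : Label) s →
  Vec.toList (Vec.tabulate (λ j → L , (centre s , Vec.lookup (leaves s) j))) ≡ map (L ,_) (starEdges s)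
labelledStar-const L (star c (_ Vec.∷ _ Vec.∷ _ Vec.∷ _ Vec.∷ _ Vec.∷ Vec.[])) = refl

labelledEdges-const : ∀ (L : Label) F → labelledEdges F (λ _ _ → L) ≡ map (L ,_) (edges F)
labelledEdges-const L []      = refl
labelledEdges-const L (s ∷ F) = trans (cong₂ _++_ (labelledStar-const L s) (labelledEdges-const L F))
                                      (sym (map-++ (L ,_) (starEdges s) (edges F)))

labelledEdges-split : ∀ A R → labelledEdges (A ++ R) (splitLabelling A R) ≡ map (pure ,_) (edges A) ++ map (prime ,_) (edges R)
labelledEdges-split []      R = labelledEdges-const prime R
labelledEdges-split (s ∷ A) R = begin
  labelledEdges (s ∷ A ++ R) (splitLabelling (s ∷ A) R)
    ≡⟨ cong (_++ labelledEdges (A ++ R) (splitLabelling A R)) (labelledStar-const pure s) ⟩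
  map (pure ,_) (starEdges s) ++ labelledEdges (A ++ R) (splitLabelling A R)
    ≡⟨ cong (map (pure ,_) (starEdges s) ++_) (labelledEdges-split A R) ⟩
  map (pure ,_) (starEdges s) ++ (map (pure ,_) (edges A) ++ map (prime ,_) (edges R))
    ≡⟨ ++-assoc (map (pure ,_) (starEdges s)) _ _ ⟨
  (map (pure ,_) (starEdges s) ++ map (pure ,_) (edges A)) ++ map (prime ,_) (edges R)
    ≡⟨ cong (_++ map (prime ,_) (edges R)) (map-++ (pure ,_) (starEdges s) (edges A)) ⟨
  map (pure ,_) (edges (s ∷ A)) ++ map (prime ,_) (edges R) ∎
  where open ≡-Reasoning

module _ {g : ℕ} where

  private
    selectedDiffs : Label → List (Label × Edge) → List ℕ
    selectedDiffs L ps = map (λ p → diff g (proj₂ p)) (filter (λ p → proj₁ p ≟L L) ps)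

    pureDiffs : ∀ xs ys → selectedDiffs pure (map (pure ,_) xs ++ map (prime ,_) ys) ≡ map (diff g) xs
    pureDiffs (x ∷ xs) ys       = cong (diff g x ∷_) (pureDiffs xs ys)
    pureDiffs []       (y ∷ ys) = pureDiffs [] ys
    pureDiffs []       []       = refl

    primeDiffs : ∀ xs ys → selectedDiffs prime (map (pure ,_) xs ++ map (prime ,_) ys) ≡ map (diff g) ys
    primeDiffs (x ∷ xs) ys       = primeDiffs xs ys
    primeDiffs []       (y ∷ ys) = cong (diff g y ∷_) (primeDiffs [] ys)
    primeDiffs []       []       = refl

  splitLabelling-purePrime : ∀ A R → Unique (map (diff g) (edges A)) → Unique (map (diff g) (edges R)) →
                             IsPurePrimeLabelling g (A ++ R) (splitLabelling A R)
  splitLabelling-purePrime A R uniqueA uniqueR =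
      subst Unique (sym (trans (cong (selectedDiffs pure) (labelledEdges-split A R)) (pureDiffs (edges A) (edges R)))) uniqueA
    , subst Unique (sym (trans (cong (selectedDiffs prime) (labelledEdges-split A R)) (primeDiffs (edges A) (edges R)))) uniqueR

module Construction (m : ℕ) where

  c : ℕ
  c = ⌈ 3 * m + 1 /2⌉

  f : ℕ
  f = ⌊ 3 * m + 1 /2⌋

  c+f≡ : c + f ≡ 3 * m + 1
  c+f≡ = trans (+-comm c f) (⌊n/2⌋+⌈n/2⌉≡n (3 * m + 1))

  A : List Star
  A = block 0 c f

  hA : ℕ
  hA = hole 0 c f

  sB : ℕ
  sB = suc (6 * (c + f))

  B : List Star
  B = block sB m m

  hB : ℕ
  hB = hole sB m m

  last4 : ℕ
  last4 = sB + suc (6 * (m + m))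

  S : Star
  S = star hA (hB Vec.∷ last4 Vec.∷ suc last4 Vec.∷ suc (suc last4) Vec.∷ suc (suc (suc last4)) Vec.∷ Vec.[])

  R : List Star
  R = B ++ S ∷ []

  F : List Star
  F = A ++ R

  F-factor : FiveStarFactor (30 * m + 12) F
  F-factor = begin
    concatMap verts (A ++ B ++ S ∷ [])
      ≡⟨ split-verts ⟩
    VA ++ (VB ++ (hA ∷ hB ∷ interval last4 4))
      ↭⟨ ↭-solve 5 (λ a b x y t → a ⊕ (b ⊕ (x ⊕ (y ⊕ t))) ⊜ (x ⊕ a) ⊕ ((y ⊕ b) ⊕ t))
                   ↭-refl VA VB (hA ∷ []) (hB ∷ []) (interval last4 4) ⟩
    (hA ∷ VA) ++ ((hB ∷ VB) ++ interval last4 4)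
      ↭⟨ ++⁺ (block-verts 0 c f) (++⁺ (block-verts sB m m) ↭-refl) ⟩
    interval 0 sB ++ (interval sB (suc (6 * (m + m))) ++ interval last4 4)
      ≡⟨ cong (interval 0 sB ++_) (interval-++ (suc (6 * (m + m))) 4 refl) ⟩
    interval 0 sB ++ interval sB (suc (6 * (m + m)) + 4)
      ≡⟨ interval-++ sB (suc (6 * (m + m)) + 4) refl ⟩
    interval 0 (sB + (suc (6 * (m + m)) + 4))
      ≡⟨ cong (interval 0) size ⟩
    interval 0 (30 * m + 12)
      ≡⟨ upTo≡interval (30 * m + 12) ⟨
    upTo (30 * m + 12) ∎
    where
    open PermutationReasoning
    VA VB : List ℕ
    VA = concatMap verts A
    VB = concatMap verts B
    split-verts : concatMap verts (A ++ B ++ S ∷ []) ≡ VA ++ (VB ++ verts S)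
    split-verts = trans (concatMap-++ verts A (B ++ S ∷ []))
      (cong (VA ++_) (trans (concatMap-++ verts B (S ∷ [])) (cong (VB ++_) (++-identityʳ (verts S)))))
    total : ∀ m → suc (6 * (3 * m + 1)) + (suc (6 * (m + m)) + 4) ≡ 30 * m + 12
    total = solve-∀
    size : suc (6 * (c + f)) + (suc (6 * (m + m)) + 4) ≡ 30 * m + 12
    size = trans (cong (λ x → suc (6 * x) + (suc (6 * (m + m)) + 4)) c+f≡) (total m)

  half : ℕ
  half = suc (15 * m + 5)

  g≡half+half : 30 * m + 12 ≡ suc (15 * m + 5) + suc (15 * m + 5)
  g≡half+half = solve (m ∷ [])

  f≤ : f ≤ 3 * m + 1
  f≤ = subst (f ≤_) c+f≡ (m≤n+m f c)

  u0 : ℕ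
  u0 = suc (f + 11 * m)

  u1 : ℕ
  u1 = suc (suc (f + 12 * m))

  low : ℕ
  low = 5 * (m + m)

  lengthsS : starLengths S ≡ u0 ∷ interval u1 4
  lengthsS = cong₂ _∷_ (len-above {hA} u0 (hB≡ c f m)) (begin
    map (λ l → len (hA , l)) (interval last4 4)     ≡⟨ cong (λ x → map (λ l → len (hA , l)) (interval x 4)) (last4≡ c f m) ⟩
    map (λ l → len (hA , l)) (interval (hA + u1) 4) ≡⟨ lengths-to-interval hA u1 4 ⟩
    interval u1 4                                    ∎)
    where
    open ≡-Reasoning
    hB≡ : ∀ c f m → suc (6 * (c + f)) + m + 5 * (m + m) ≡ c + 5 * (c + f) + suc (f + 11 * m)
    hB≡ = solve-∀
    last4≡ : ∀ c f m → suc (6 * (c + f)) + suc (6 * (m + m)) ≡ c + 5 * (c + f) + suc (suc (f + 12 * m))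
    last4≡ = solve-∀

  lengthsA : map len (edges A) ↭ interval 1 (15 * m + 5)
  lengthsA = subst (λ k → map len (edges A) ↭ interval 1 k) five-columns
    (block-lengths 0 c f (⌈n/2⌉-⌊n/2⌋-balanced (3 * m + 1)))
    where
    five-columns : 5 * (c + f) ≡ 15 * m + 5
    five-columns = trans (cong (5 *_) c+f≡) (solve (m ∷ []))

  lengthsR : map len (edges R) ↭ interval 1 low ++ u0 ∷ interval u1 4
  lengthsR = begin
    map len (edges (B ++ S ∷ []))                   ≡⟨ lengths-++ B (S ∷ []) ⟩
    map len (edges B) ++ map len (starEdges S ++ []) ≡⟨ cong (λ es → map len (edges B) ++ map len es) (++-identityʳ (starEdges S)) ⟩
    map len (edges B) ++ starLengths S              ↭⟨ ++⁺ (block-lengths sB m m (inj₁ refl)) (↭-reflexive lengthsS) ⟩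
    interval 1 low ++ u0 ∷ interval u1 4            ∎
    where open PermutationReasoning

  low<u0 : suc low ≤ u0
  low<u0 = s≤s (≤-trans (m≤m+n low (f + m)) (≤-reflexive (regroup f m)))
    where
    regroup : ∀ f m → 5 * (m + m) + (f + m) ≡ f + 11 * m
    regroup = solve-∀

  u0<u1 : u0 < u1
  u0<u1 = s≤s (s≤s (+-monoʳ-≤ f (*-monoˡ-≤ m (n≤1+n 11))))

  low≤half : low ≤ half
  low≤half = ≤-trans (m≤m+n low (5 * m + 6)) (≤-reflexive (regroup m))
    where
    regroup : ∀ m → 5 * (m + m) + (5 * m + 6) ≡ suc (15 * m + 5)
    regroup = solve-∀

  u1+4≤1+half : u1 + 4 ≤ suc half
  u1+4≤1+half = begin
    u1 + 4               ≡⟨ regroup₁ f m ⟩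
    f + (12 * m + 6)     ≤⟨ +-monoˡ-≤ (12 * m + 6) f≤ ⟩
    3 * m + 1 + (12 * m + 6) ≡⟨ regroup₂ m ⟩
    suc half             ∎
    where
    open ≤-Reasoning
    regroup₁ : ∀ f m → suc (suc (f + 12 * m)) + 4 ≡ f + (12 * m + 6)
    regroup₁ = solve-∀
    regroup₂ : ∀ m → 3 * m + 1 + (12 * m + 6) ≡ suc (suc (15 * m + 5))
    regroup₂ = solve-∀

  S-above-low : All (suc low ≤_) (u0 ∷ interval u1 4)
  S-above-low = low<u0 All.∷ All-interval u1 4 (λ u1≤x _ → ≤-trans (≤-trans low<u0 (<⇒≤ u0<u1)) u1≤x)

  S-below : All (_< u1 + 4) (u0 ∷ interval u1 4)
  S-below = ≤-trans u0<u1 (m≤m+n u1 4) All.∷ All-interval u1 4 (λ _ x<u1+4 → x<u1+4)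

  unique-lengthsA : Unique (map len (edges A))
  unique-lengthsA = Unique-resp-↭ (↭-sym lengthsA) (interval-unique 1 (15 * m + 5))

  unique-lengthsR : Unique (map len (edges R))
  unique-lengthsR = Unique-resp-↭ (↭-sym lengthsR)
    (Unique-++-separated (suc low) (All-interval 1 low (λ _ x<1+low → x<1+low)) S-above-low
      (interval-unique 1 low)
      (All-interval u1 4 (λ u1≤x _ → <⇒≢ (≤-trans u0<u1 u1≤x)) AllPairs.∷ interval-unique u1 4))

  shortA : All (_≤ half) (map len (edges A))
  shortA = All-resp-↭ (↭-sym lengthsA) (All-interval 1 (15 * m + 5) (λ _ x<half → <⇒≤ x<half))

  shortR : All (_≤ half) (map len (edges R))
  shortR = All-resp-↭ (↭-sym lengthsR) (All.++⁺
    (All-interval 1 low (λ _ x<1+low → ≤-trans (≤-pred x<1+low) low≤half))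
    (All.map (λ x<u1+4 → ≤-pred (≤-trans x<u1+4 u1+4≤1+half)) S-below))

  lengthsF-cover : ∀ d → 1 ≤ d → d ≤ 15 * m + 5 → d ∈ map len (edges F)
  lengthsF-cover d 1≤d d≤15m+5 = subst (d ∈_) (sym (lengths-++ A R))
    (∈-++⁺ˡ (∈-resp-↭ (↭-sym lengthsA) (∈-interval⁺ (15 * m + 5) 1≤d (s≤s d≤15m+5))))

lemma3p4 : (m : ℕ) →
    Σ (List Star) λ F →
      FiveStarFactor (30 * m + 12) F
      × (∀ d → 1 ≤ d → d ≤ 15 * m + 5 →
           ∃ λ e → e ∈ edges F × HasForwardDiff (30 * m + 12) d e)
      × (∀ d → 1 ≤ d → d ≤ 15 * m + 5 → countForward (30 * m + 12) d F ≤ 2)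
      × All (λ e → ¬ IsWrapAround (30 * m + 12) e) (edges F)
      × (Σ (Labelling F) λ λl →
           IsPurePrimeLabelling (30 * m + 12) F λl
           × (∀ (i : Fin (length F)) → ¬ Mixed F λl i))
lemma3p4 m =
  F , F-factor
  , (λ d 1≤d d≤ → forwardDiff-cover forwardF (lengthsF-cover d 1≤d d≤))
  , (λ d _ _ → countForward-++ d A R uniqueA uniqueR)
  , All.map (λ forward wrapAround → wrapAround forward) forwardF
  , splitLabelling A R , splitLabelling-purePrime A R uniqueA uniqueR , starwise-unmixed F _
  where
  open Construction m
  forwardA : All (IsForward (30 * m + 12)) (edges A)
  forwardA = forward-edges g≡half+half shortA
  forwardR : All (IsForward (30 * m + 12)) (edges R)
  forwardR = forward-edges g≡half+half shortR
  forwardF : All (IsForward (30 * m + 12)) (edges F)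
  forwardF = subst (All _) (sym (edges-++ A R)) (All.++⁺ forwardA forwardR)
  uniqueA : Unique (map (diff (30 * m + 12)) (edges A))
  uniqueA = unique-diffs forwardA unique-lengthsA
  uniqueR : Unique (map (diff (30 * m + 12)) (edges R))
  uniqueR = unique-diffs forwardR unique-lengthsR
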